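{- Let $A$ be a DLCMI, $a,b\in A$, and $(c,d),(u,w)\in R(a,b)$. Then there are natural numbers $n$ and $k$ such that: (1) $t_n^{2k}(a,b)\cdot(c\to u)\le d\to w$; (2) $t_n^{2k}(a,b)\cdot((c\to u)\wedge a\wedge b)\le (d\to w)\wedge a\wedge b$; (3) $t_n^{2k}(a,b)\cdot((d\to w)\wedge a\wedge b)\le (c\to u)\wedge a\wedge b$; (4) $t_n^{2k}(a,b)\cdot((c\to u)\vee a\vee b)\le (d\to w)\vee a\vee b$; (5) $t_n^{2k}(a,b)\cdot((d\to w)\vee a\vee b)\le (c\to u)\vee a\vee b$; (6) $t_{n+1}^{2k}(a,b)\le (c\to u)\leftrightarrow(d\to w)$.
   Context: A DLCMI is an algebra $(A,\wedge,\vee,\cdot,\to,1)$ of type $(2,2,2,2,0)$ such that for all $a,b,c\in A$: (1) $(A,\wedge,\vee)$ is a distributive lattice; (2) $1$ is the largest element; (3) $(A,\cdot,1)$ is a commutative monoid; (4) $(a\to b)\wedge(a\to c)=a\to(b\wedge c)$; (5) $(a\to c)\wedge(b\to c)=(a\vee b)\to c$; (6) $a\to a=1$; (7) $(a\vee b)\cdot c=(a\cdot c)\vee(b\cdot c)$; (8) $(a\to b)\cdot(b\to c)\le a\to c$; (9) $a\to b\le (a\cdot c)\to(b\cdot c)$. Notation: $x^0=1$, $x^{n}=x\cdot x^{n-1}$; $\Box(x)=1\to x$, $\Box^0(x)=x$, $\Box^{n+1}(x)=\Box(\Box^n(x))$; $x\leftrightarrow y=(x\to y)\wedge(y\to x)$;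 $t_n(a,b)=\Box^0(a\leftrightarrow b)\wedge\Box(a\leftrightarrow b)\wedge\cdots\wedge\Box^n(a\leftrightarrow b)$ for $n\ge 0$; $t_n^k(a,b)=(t_n(a,b))^k$. The relation $R(a,b)$ on $A$: $(c,d)\in R(a,b)$ iff there are natural numbers $n,k$ such that (C1) $t_n^k(a,b)\cdot(c\wedge a\wedge b)\le d\wedge a\wedge b$ and $t_n^k(a,b)\cdot(d\wedge a\wedge b)\le c\wedge a\wedge b$; (C2) $t_n^k(a,b)\cdot(c\vee a\vee b)\le d\vee a\vee b$ and $t_n^k(a,b)\cdot(d\vee a\vee b)\le c\vee a\vee b$; (C3) $t_n^k(a,b)\le c\leftrightarrow d$. -}

module Defs where

open import Level using (Level; suc)
open import Data.Nat using (ℕ; zero) renaming (suc to sucℕ)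
open import Data.Product using (∃; _×_; Σ-syntax)
open import Relation.Binary.PropositionalEquality using (_≡_)

record DLCMI (ℓ : Level) : Set (suc ℓ) where
  infixr 6 _∨_
  infixr 7 _∧_
  infixl 8 _·_
  infixr 5 _⇒_
  infix 5 _⇔_
  infix 4 _≤_
  field
    Carrier : Set ℓ
    _∧_ _∨_ _·_ _⇒_ : Carrier → Carrier → Carrier
    𝟏 : Carrier

  _≤_ : Carrier → Carrier → Set ℓ
  x ≤ y = x ∧ y ≡ x

  field
    ∧-comm : ∀ x y → x ∧ y ≡ y ∧ x
    ∨-comm : ∀ x y → x ∨ y ≡ y ∨ x
    ∧-assoc : ∀ x y z → (x ∧ y) ∧ z ≡ x ∧ (y ∧ z)
    ∨-assoc : ∀ x y z → (x ∨ y) ∨ z ≡ x ∨ (y ∨ z)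
    ∧-absorbs-∨ : ∀ x y → x ∧ (x ∨ y) ≡ x
    ∨-absorbs-∧ : ∀ x y → x ∨ (x ∧ y) ≡ x
    ∧-distribˡ-∨ : ∀ x y z → x ∧ (y ∨ z) ≡ (x ∧ y) ∨ (x ∧ z)
    ≤-𝟏 : ∀ x → x ≤ 𝟏
    ·-comm : ∀ x y → x · y ≡ y · x
    ·-assoc : ∀ x y z → (x · y) · z ≡ x · (y · z)
    ·-identityˡ : ∀ x → 𝟏 · x ≡ x
    ⇒-∧ʳ : ∀ a b c → (a ⇒ b) ∧ (a ⇒ c) ≡ a ⇒ (b ∧ c)
    ⇒-∨ˡ : ∀ a b c → (a ⇒ c) ∧ (b ⇒ c) ≡ (a ∨ b) ⇒ c
    ⇒-refl : ∀ a → a ⇒ a ≡ 𝟏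
    ·-distribʳ-∨ : ∀ a b c → (a ∨ b) · c ≡ (a · c) ∨ (b · c)
    -- (8)
    ⇒-trans : ∀ a b c → (a ⇒ b) · (b ⇒ c) ≤ a ⇒ c
    ⇒-·-mono : ∀ a b c → a ⇒ b ≤ (a · c) ⇒ (b · c)

  _^_ : Carrier → ℕ → Carrier
  x ^ zero = 𝟏
  x ^ sucℕ n = x · (x ^ n)

  □ : Carrier → Carrier
  □ x = 𝟏 ⇒ x

  □^ : ℕ → Carrier → Carrier
  □^ zero x = x
  □^ (sucℕ n) x = □ (□^ n x)

  _⇔_ : Carrier → Carrier → Carrier
  x ⇔ y = (x ⇒ y) ∧ (y ⇒ x)

  t : ℕ → Carrier → Carrier → Carrier
  t zero a b = □^ zero (a ⇔ b)
  t (sucℕ n) a b = t n a b ∧ □^ (sucℕ n) (a ⇔ b)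

  tk : ℕ → ℕ → Carrier → Carrier → Carrier
  tk n k a b = t n a b ^ k

  R : Carrier → Carrier → Carrier → Carrier → Set ℓ
  R a b c d = ∃ λ n → ∃ λ k →
      (tk n k a b · (c ∧ a ∧ b) ≤ d ∧ a ∧ b)
    × (tk n k a b · (d ∧ a ∧ b) ≤ c ∧ a ∧ b)
    × (tk n k a b · (c ∨ a ∨ b) ≤ d ∨ a ∨ b)
    × (tk n k a b · (d ∨ a ∨ b) ≤ c ∨ a ∨ b)
    × (tk n k a b ≤ c ⇔ d)

-- Only condition (C3) of the two hypotheses is needed.  Since t_n^k is
-- antitone in n and k, taking n and k to be the sums of the two witnesses
-- gives T = t_n^k below both c ↔ d and u ↔ w.  Two applications of axiom (8)
-- then give T · T · (c → u) ≤ (d → c) · (c → u) · (u → w) ≤ d → w, and the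
-- meet and join forms follow because multiplication is integral (x · y ≤ y).
-- For (6), t_{n+1}^k ≤ □(t_n^k) because □ is submultiplicative, and
-- □(d → c) · □(u → w) ≤ (c → u) → (d → w) by pre- and postcomposition.
module Submission where

open import Defs
open import Data.Nat using (ℕ; suc; _*_)
open import Data.Product using (∃; _×_)
open import Algebra.Bundles using (CommutativeSemigroup)
open import Algebra.Lattice.Bundles using (Lattice)
import Algebra.Lattice.Properties.Lattice as AlgebraicLatticeProperties
import Algebra.Properties.CommutativeSemigroup as CommutativeSemigroupProperties
open import Data.Nat as ℕ using (zero; _+_; z≤n; s≤s; _≤′_; ≤′-refl; ≤′-step)
open import Data.Nat.Properties using (+-identityʳ; ≤⇒≤′; m≤m+n; m≤n+m)
open import Data.Product using (_,_)
import Relation.Binary.Lattice.Bundles as OrderTheoretic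
import Relation.Binary.Lattice.Properties.JoinSemilattice as JoinSemilatticeProperties
import Relation.Binary.Lattice.Properties.MeetSemilattice as MeetSemilatticeProperties
open import Relation.Binary.Bundles using (Poset)
import Relation.Binary.Reasoning.PartialOrder as PartialOrderReasoning
open import Relation.Binary.PropositionalEquality
  using (_≡_; sym; trans; cong; cong₂; subst; subst₂; isEquivalence; module ≡-Reasoning)

module Properties {ℓ} (A : DLCMI ℓ) where
  open DLCMI A

  lattice : Lattice ℓ ℓ
  lattice = record
    { isLattice = record
      { isEquivalence = isEquivalence
      ; ∨-comm = ∨-comm
      ; ∨-assoc = ∨-assoc
      ; ∨-cong = cong₂ _∨_
      ; ∧-comm = ∧-comm
      ; ∧-assoc = ∧-assoc
      ; ∧-cong = cong₂ _∧_
      ; absorptive = ∨-absorbs-∧ , ∧-absorbs-∨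
      }
    }

  -- The library orders a lattice by x ≡ x ∧ y, the symmetric form of _≤_.
  private
    module L = OrderTheoretic.Lattice (AlgebraicLatticeProperties.∨-∧-orderTheoreticLattice lattice)
    module J = JoinSemilatticeProperties L.joinSemilattice
    module M = MeetSemilatticeProperties L.meetSemilattice

  ≤-refl : ∀ {x} → x ≤ x
  ≤-refl = sym L.refl

  ≤-reflexive : ∀ {x y} → x ≡ y → x ≤ y
  ≤-reflexive x≡y = sym (L.reflexive x≡y)

  ≤-trans : ∀ {x y z} → x ≤ y → y ≤ z → x ≤ z
  ≤-trans x≤y y≤z = sym (L.trans (sym x≤y) (sym y≤z))

  x∧y≤x : ∀ x y → x ∧ y ≤ x
  x∧y≤x x y = sym (L.x∧y≤x x y)

  x∧y≤y : ∀ x y → x ∧ y ≤ y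
  x∧y≤y x y = sym (L.x∧y≤y x y)

  ∧-greatest : ∀ {x y z} → x ≤ y → x ≤ z → x ≤ y ∧ z
  ∧-greatest x≤y x≤z = sym (L.∧-greatest (sym x≤y) (sym x≤z))

  ∧-monotonic : ∀ {x x′ y y′} → x ≤ x′ → y ≤ y′ → x ∧ y ≤ x′ ∧ y′
  ∧-monotonic x≤x′ y≤y′ = sym (M.∧-monotonic (sym x≤x′) (sym y≤y′))

  ∨-monotonic : ∀ {x x′ y y′} → x ≤ x′ → y ≤ y′ → x ∨ y ≤ x′ ∨ y′
  ∨-monotonic x≤x′ y≤y′ = sym (J.∨-monotonic (sym x≤x′) (sym y≤y′))

  x≤y⇒x∨y≡y : ∀ {x y} → x ≤ y → x ∨ y ≡ y
  x≤y⇒x∨y≡y x≤y = J.x≤y⇒x∨y≈y (sym x≤y)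

  ≤-poset : Poset ℓ ℓ ℓ
  ≤-poset = record
    { _≤_ = _≤_
    ; isPartialOrder = record
      { isPreorder = record { isEquivalence = isEquivalence ; reflexive = ≤-reflexive ; trans = ≤-trans }
      ; antisym = λ x≤y y≤x → L.antisym (sym x≤y) (sym y≤x)
      }
    }

  module ≤-Reasoning = PartialOrderReasoning ≤-poset

  ·-commutativeSemigroup : CommutativeSemigroup ℓ ℓ
  ·-commutativeSemigroup = record
    { _∙_ = _·_
    ; isCommutativeSemigroup = record
      { isSemigroup = record
        { isMagma = record { isEquivalence = isEquivalence ; ∙-cong = cong₂ _·_ }
        ; assoc = ·-assoc
        }
      ; comm = ·-comm
      }
    }

  open CommutativeSemigroupProperties ·-commutativeSemigroup using (xy∙z≈xz∙y)

  ·-distribˡ-∨ : ∀ x y z → x · (y ∨ z) ≡ x · y ∨ x · z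
  ·-distribˡ-∨ x y z = begin
    x · (y ∨ z)     ≡⟨ ·-comm x (y ∨ z) ⟩
    (y ∨ z) · x     ≡⟨ ·-distribʳ-∨ y z x ⟩
    y · x ∨ z · x   ≡⟨ cong₂ _∨_ (·-comm y x) (·-comm z x) ⟩
    x · y ∨ x · z   ∎
    where open ≡-Reasoning

  ·-monoˡ : ∀ {x y} z → x ≤ y → x · z ≤ y · z
  ·-monoˡ {x} {y} z x≤y = begin
    x · z ∧ y · z             ≡⟨ cong (λ v → x · z ∧ v · z) (x≤y⇒x∨y≡y x≤y) ⟨
    x · z ∧ (x ∨ y) · z       ≡⟨ cong (x · z ∧_) (·-distribʳ-∨ x y z) ⟩
    x · z ∧ (x · z ∨ y · z)   ≡⟨ ∧-absorbs-∨ (x · z) (y · z) ⟩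
    x · z                     ∎
    where open ≡-Reasoning

  ·-monoʳ : ∀ {x y} z → x ≤ y → z · x ≤ z · y
  ·-monoʳ {x} {y} z x≤y = subst₂ _≤_ (·-comm x z) (·-comm y z) (·-monoˡ z x≤y)

  ·-mono : ∀ {x x′ y y′} → x ≤ x′ → y ≤ y′ → x · y ≤ x′ · y′
  ·-mono {x′ = x′} {y = y} x≤x′ y≤y′ = ≤-trans (·-monoˡ y x≤x′) (·-monoʳ x′ y≤y′)

  x·y≤y : ∀ x y → x · y ≤ y
  x·y≤y x y = subst (x · y ≤_) (·-identityˡ y) (·-monoˡ y (≤-𝟏 x))

  ·-∧-preserves-≤ : ∀ {x y z} m → x · y ≤ z → x · (y ∧ m) ≤ z ∧ m
  ·-∧-preserves-≤ {x} {y} m xy≤z =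
    ∧-greatest (≤-trans (·-monoʳ x (x∧y≤x y m)) xy≤z) (≤-trans (x·y≤y x _) (x∧y≤y y m))

  ·-∨-preserves-≤ : ∀ {x y z} m → x · y ≤ z → x · (y ∨ m) ≤ z ∨ m
  ·-∨-preserves-≤ {x} {y} m xy≤z =
    subst (_≤ _) (sym (·-distribˡ-∨ x y m)) (∨-monotonic xy≤z (x·y≤y x m))

  ^-+ : ∀ x m n → x ^ (m + n) ≡ x ^ m · x ^ n
  ^-+ x zero    n = sym (·-identityˡ (x ^ n))
  ^-+ x (suc m) n = trans (cong (x ·_) (^-+ x m n)) (sym (·-assoc x (x ^ m) (x ^ n)))

  ^-double : ∀ x k → x ^ (2 * k) ≡ x ^ k · x ^ k
  ^-double x k = trans (^-+ x k (k + 0)) (cong (λ m → x ^ k · x ^ m) (+-identityʳ k))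

  ^-monoˡ : ∀ {x y} k → x ≤ y → x ^ k ≤ y ^ k
  ^-monoˡ zero    x≤y = ≤-refl
  ^-monoˡ (suc k) x≤y = ·-mono x≤y (^-monoˡ k x≤y)

  ^-antitoneʳ : ∀ x {j k} → j ℕ.≤ k → x ^ k ≤ x ^ j
  ^-antitoneʳ x z≤n       = ≤-𝟏 _
  ^-antitoneʳ x (s≤s j≤k) = ·-monoʳ x (^-antitoneʳ x j≤k)

  ⇒-monoʳ : ∀ {x y} z → x ≤ y → z ⇒ x ≤ z ⇒ y
  ⇒-monoʳ {x} {y} z x≤y = trans (⇒-∧ʳ z x y) (cong (z ⇒_) x≤y)

  ≤-⇔-forward : ∀ {x p q} → x ≤ p ⇔ q → x ≤ p ⇒ q
  ≤-⇔-forward {p = p} {q} x≤p⇔q = ≤-trans x≤p⇔q (x∧y≤x (p ⇒ q) (q ⇒ p))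

  ≤-⇔-backward : ∀ {x p q} → x ≤ p ⇔ q → x ≤ q ⇒ p
  ≤-⇔-backward {p = p} {q} x≤p⇔q = ≤-trans x≤p⇔q (x∧y≤y (p ⇒ q) (q ⇒ p))

  ⇒-sandwich : ∀ {x y p q r s} → x ≤ q ⇒ p → y ≤ r ⇒ s → x · y · (p ⇒ r) ≤ q ⇒ s
  ⇒-sandwich {x} {y} {p} {q} {r} {s} x≤q⇒p y≤r⇒s = begin
    x · y · (p ⇒ r)               ≡⟨ xy∙z≈xz∙y x y (p ⇒ r) ⟩
    x · (p ⇒ r) · y               ≤⟨ ·-mono (·-monoˡ (p ⇒ r) x≤q⇒p) y≤r⇒s ⟩
    (q ⇒ p) · (p ⇒ r) · (r ⇒ s)   ≤⟨ ·-monoˡ (r ⇒ s) (⇒-trans q p r) ⟩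
    (q ⇒ r) · (r ⇒ s)             ≤⟨ ⇒-trans q r s ⟩
    q ⇒ s                         ∎
    where open ≤-Reasoning

  □-mono : ∀ {x y} → x ≤ y → □ x ≤ □ y
  □-mono = ⇒-monoʳ 𝟏

  □-∧ : ∀ x y → □ x ∧ □ y ≡ □ (x ∧ y)
  □-∧ = ⇒-∧ʳ 𝟏

  □≤⇒· : ∀ x y → □ x ≤ y ⇒ x · y
  □≤⇒· x y = subst (λ v → □ x ≤ v ⇒ x · y) (·-identityˡ y) (⇒-·-mono 𝟏 x y)

  □-· : ∀ x y → □ x · □ y ≤ □ (x · y)
  □-· x y = begin
    □ x · □ y            ≤⟨ ·-monoʳ (□ x) (□≤⇒· y x) ⟩
    (𝟏 ⇒ x) · (x ⇒ y · x) ≤⟨ ⇒-trans 𝟏 x (y · x) ⟩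
    □ (y · x)            ≡⟨ cong □ (·-comm y x) ⟩
    □ (x · y)            ∎
    where open ≤-Reasoning

  □-^ : ∀ x k → □ x ^ k ≤ □ (x ^ k)
  □-^ x zero    = ≤-reflexive (sym (⇒-refl 𝟏))
  □-^ x (suc k) = ≤-trans (·-monoʳ (□ x) (□-^ x k)) (□-· x (x ^ k))

  □-⇒-precompose : ∀ p q r → □ (q ⇒ p) ≤ (p ⇒ r) ⇒ (q ⇒ r)
  □-⇒-precompose p q r = ≤-trans (□≤⇒· (q ⇒ p) (p ⇒ r)) (⇒-monoʳ (p ⇒ r) (⇒-trans q p r))

  □-⇒-postcompose : ∀ q r s → □ (r ⇒ s) ≤ (q ⇒ r) ⇒ (q ⇒ s)
  □-⇒-postcompose q r s = ≤-trans (□≤⇒· (r ⇒ s) (q ⇒ r))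
    (⇒-monoʳ (q ⇒ r) (subst (_≤ q ⇒ s) (·-comm (q ⇒ r) (r ⇒ s)) (⇒-trans q r s)))

  □-⇒-sandwich : ∀ {x y p q r s} → x ≤ q ⇒ p → y ≤ r ⇒ s → □ x · □ y ≤ (p ⇒ r) ⇒ (q ⇒ s)
  □-⇒-sandwich {x} {y} {p} {q} {r} {s} x≤q⇒p y≤r⇒s = begin
    □ x · □ y                                           ≤⟨ ·-mono (□-mono x≤q⇒p) (□-mono y≤r⇒s) ⟩
    □ (q ⇒ p) · □ (r ⇒ s)                               ≤⟨ ·-mono (□-⇒-precompose p q r) (□-⇒-postcompose q r s) ⟩
    ((p ⇒ r) ⇒ (q ⇒ r)) · ((q ⇒ r) ⇒ (q ⇒ s))           ≤⟨ ⇒-trans (p ⇒ r) (q ⇒ r) (q ⇒ s) ⟩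
    (p ⇒ r) ⇒ (q ⇒ s)                                   ∎
    where open ≤-Reasoning

  t-antitone : ∀ {m n} a b → m ≤′ n → t n a b ≤ t m a b
  t-antitone a b ≤′-refl          = ≤-refl
  t-antitone a b (≤′-step {n} m≤n) = ≤-trans (x∧y≤x (t n a b) _) (t-antitone a b m≤n)

  t-suc≤□t : ∀ n a b → t (suc n) a b ≤ □ (t n a b)
  t-suc≤□t zero    a b = x∧y≤y (a ⇔ b) (□ (a ⇔ b))
  t-suc≤□t (suc n) a b = subst (t (suc (suc n)) a b ≤_) (□-∧ (t n a b) (□^ (suc n) (a ⇔ b)))
    (∧-monotonic (t-suc≤□t n a b) ≤-refl)

  tk-antitone : ∀ {m n j k} a b → m ℕ.≤ n → j ℕ.≤ k → tk n k a b ≤ tk m j a b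
  tk-antitone {m} {n} {j} {k} a b m≤n j≤k =
    ≤-trans (^-antitoneʳ (t n a b) j≤k) (^-monoˡ j (t-antitone a b (≤⇒≤′ m≤n)))

  tk-suc≤□tk : ∀ n k a b → tk (suc n) k a b ≤ □ (tk n k a b)
  tk-suc≤□tk n k a b = ≤-trans (^-monoˡ k (t-suc≤□t n a b)) (□-^ (t n a b) k)

  tk-double-sandwich : ∀ n k a b {p q r s} → tk n k a b ≤ q ⇒ p → tk n k a b ≤ r ⇒ s →
                       tk n (2 * k) a b · (p ⇒ r) ≤ q ⇒ s
  tk-double-sandwich n k a b {p} {q} {r} {s} T≤q⇒p T≤r⇒s =
    subst (λ v → v · (p ⇒ r) ≤ q ⇒ s) (sym (^-double (t n a b) k)) (⇒-sandwich T≤q⇒p T≤r⇒s)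

  tk-suc-double-sandwich : ∀ n k a b {p q r s} → tk n k a b ≤ q ⇒ p → tk n k a b ≤ r ⇒ s →
                           tk (suc n) (2 * k) a b ≤ (p ⇒ r) ⇒ (q ⇒ s)
  tk-suc-double-sandwich n k a b {p} {q} {r} {s} T≤q⇒p T≤r⇒s = begin
    tk (suc n) (2 * k) a b              ≡⟨ ^-double (t (suc n) a b) k ⟩
    tk (suc n) k a b · tk (suc n) k a b ≤⟨ ·-mono (tk-suc≤□tk n k a b) (tk-suc≤□tk n k a b) ⟩
    □ (tk n k a b) · □ (tk n k a b)     ≤⟨ □-⇒-sandwich T≤q⇒p T≤r⇒s ⟩
    (p ⇒ r) ⇒ (q ⇒ s)                   ∎
    where open ≤-Reasoning

lemma3p8 : ∀ {ℓ} (A : DLCMI ℓ) → let open DLCMI A in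
    ∀ (a b c d u w : Carrier) → R a b c d → R a b u w →
    ∃ λ n → ∃ λ k →
        (tk n (2 * k) a b · (c ⇒ u) ≤ d ⇒ w)
      × (tk n (2 * k) a b · ((c ⇒ u) ∧ a ∧ b) ≤ (d ⇒ w) ∧ a ∧ b)
      × (tk n (2 * k) a b · ((d ⇒ w) ∧ a ∧ b) ≤ (c ⇒ u) ∧ a ∧ b)
      × (tk n (2 * k) a b · ((c ⇒ u) ∨ a ∨ b) ≤ (d ⇒ w) ∨ a ∨ b)
      × (tk n (2 * k) a b · ((d ⇒ w) ∨ a ∨ b) ≤ (c ⇒ u) ∨ a ∨ b)
      × (tk (suc n) (2 * k) a b ≤ (c ⇒ u) ⇔ (d ⇒ w))
lemma3p8 A a b c d u w (n₁ , k₁ , _ , _ , _ , _ , T₁≤c⇔d) (n₂ , k₂ , _ , _ , _ , _ , T₂≤u⇔w) =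
  n , k , cu≤dw
  , ·-∧-preserves-≤ (a ∧ b) cu≤dw
  , ·-∧-preserves-≤ (a ∧ b) dw≤cu
  , ·-∨-preserves-≤ (a ∨ b) cu≤dw
  , ·-∨-preserves-≤ (a ∨ b) dw≤cu
  , ∧-greatest (tk-suc-double-sandwich n k a b (≤-⇔-backward T≤c⇔d) (≤-⇔-forward T≤u⇔w))
               (tk-suc-double-sandwich n k a b (≤-⇔-forward T≤c⇔d) (≤-⇔-backward T≤u⇔w))
  where
  open DLCMI A
  open Properties A

  n k : ℕ
  n = n₁ + n₂
  k = k₁ + k₂

  T≤c⇔d : tk n k a b ≤ c ⇔ d
  T≤c⇔d = ≤-trans (tk-antitone a b (m≤m+n n₁ n₂) (m≤m+n k₁ k₂)) T₁≤c⇔d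

  T≤u⇔w : tk n k a b ≤ u ⇔ w
  T≤u⇔w = ≤-trans (tk-antitone a b (m≤n+m n₂ n₁) (m≤n+m k₂ k₁)) T₂≤u⇔w

  cu≤dw : tk n (2 * k) a b · (c ⇒ u) ≤ d ⇒ w
  cu≤dw = tk-double-sandwich n k a b (≤-⇔-backward T≤c⇔d) (≤-⇔-forward T≤u⇔w)

  dw≤cu : tk n (2 * k) a b · (d ⇒ w) ≤ c ⇒ u
  dw≤cu = tk-double-sandwich n k a b (≤-⇔-forward T≤c⇔d) (≤-⇔-backward T≤u⇔w)
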